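{- Let $q$ be a power of an odd prime. For $\epsilon\in\mathbb{F}_{q^3}^*$ consider the matrix $$B_\epsilon=\begin{pmatrix} 2\epsilon-\epsilon^q-\epsilon^{q^2} & (2\epsilon^{q^2}-\epsilon)^q & (2\epsilon^q-\epsilon)^{q^2}\\ 2\epsilon^q-\epsilon & (2\epsilon-\epsilon^q-\epsilon^{q^2})^q & (2\epsilon^{q^2}-\epsilon)^{q^2}\\ 2\epsilon^{q^2}-\epsilon & (2\epsilon^q-\epsilon)^q & (2\epsilon-\epsilon^q-\epsilon^{q^2})^{q^2} \end{pmatrix}.$$ Then $\det(B_\epsilon)\neq 0$ for all $\epsilon\in\mathbb{F}_{q^3}^*$. -}

module Defs where

open import Level using (0ℓ)
open import Data.Nat as ℕ using (ℕ; _≥_)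
open import Data.Nat.Primality using (Prime)
open import Data.Fin using (Fin)
open import Data.Product using (Σ; ∃; _×_)
open import Relation.Nullary using (¬_)
open import Relation.Binary.PropositionalEquality using (_≡_)
open import Algebra.Bundles using (CommutativeRing; Semiring)
import Algebra.Definitions.RawSemiring as RS

IsOddPrimePower : ℕ → Set
IsOddPrimePower q =
  Σ ℕ λ p → Σ ℕ λ k → Prime p × ¬ (p ≡ 2) × k ≥ 1 × q ≡ p ℕ.^ k

module _ (F : CommutativeRing 0ℓ 0ℓ) where
  open CommutativeRing F

  IsField : Set
  IsField = ¬ (1# ≈ 0#) × (∀ x → ¬ (x ≈ 0#) → ∃ λ y → x * y ≈ 1#)

  HasOrder : ℕ → Set
  HasOrder N = Σ (Fin N → Carrier) λ f →
    (∀ i j → f i ≈ f j → i ≡ j) × (∀ x → ∃ λ i → f i ≈ x)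

  IsFiniteFieldOfOrder : ℕ → Set
  IsFiniteFieldOfOrder N = IsField × HasOrder N

  open RS (Semiring.rawSemiring semiring) using (_^_)

  det3 : Carrier → Carrier → Carrier → Carrier → Carrier → Carrier →
         Carrier → Carrier → Carrier → Carrier
  det3 m11 m12 m13 m21 m22 m23 m31 m32 m33 =
      (m11 * m22 * m33 + m12 * m23 * m31 + m13 * m21 * m32)
    - (m13 * m22 * m31 + m12 * m21 * m33 + m11 * m23 * m32)

  two : Carrier
  two = 1# + 1#

  detB : ℕ → Carrier → Carrier
  detB q ε = det3
      a         (b ^ q)   (c ^ q2)
      c         (a ^ q)   (b ^ q2)
      b         (c ^ q)   (a ^ q2)
    where
      q2 = q ℕ.* q
      a = two * ε - ε ^ q - ε ^ q2
      b = two * (ε ^ q2) - ε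
      c = two * (ε ^ q) - ε

-- Write σ x = x ^ q and eᵢ = σⁱ ε. Translation by 1 permutes F, so summing over F gives q³ · 1 = 0;
-- hence p · 1 = 0, and σ is additive because p divides the inner binomial coefficients of p.
-- Multiplication by x ≠ 0 permutes F ∖ {0}, so ∏ x u = ∏ u over u ≠ 0 gives x ^ q³ = x, i.e. σ³ = id.
-- The entries of B_ε are therefore the linear forms 2eᵢ − eⱼ (off the diagonal) and 2eᵢ − eⱼ − eₖ
-- (on it), and a polynomial identity gives det B_ε = 2 L₀ L₁ L₂ with Lᵢ = eᵢ + eᵢ₊₁ − eᵢ₊₂.
-- As σ Lᵢ = Lᵢ₊₁, if one Lᵢ vanishes all do, and then 2ε = L₀ + L₂ = 0; but 2 ≠ 0 since p is odd.

{-# OPTIONS --safe #-}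
module Submission where

open import Level using (Level; 0ℓ)
open import Defs
open import Algebra.Bundles using (CommutativeRing; CommutativeMonoid; Monoid)
open import Data.Nat as ℕ using (ℕ; zero; suc; s≤s; s≤s⁻¹; z<s; _<_; _∸_; _!; >-nonZero⁻¹)
open import Data.Nat.Properties using (<-trans; n<1+n; <⇒≤; <⇒≱; ≤∧≢⇒<; ∸-monoʳ-<; _!*_!≢0; m∸n+n≡m; n∸n≡0; ≤-total; +-suc)
import Data.Nat.Properties as ℕₚ
open import Data.Nat.Divisibility using (_∣_; divides; _∤_; ∣1⇒≡1; ∣⇒≤; m∣m*n; ∣m∣n⇒∣m+n; ∣-refl; _∣0)
open import Data.Nat.DivMod using (m/n*n≡m)
open import Data.Nat.Primality using (Prime; euclidsLemma; ¬prime[1]; prime⇒irreducible; prime⇒nonZero)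
open import Data.Nat.Combinatorics using (_C_; nCn≡1; k![n∸k]!∣n!)
open import Data.Nat.Combinatorics.Specification using (nCk≡n!/k![n-k]!)
open import Data.Fin as Fin using (Fin; zero; suc; toℕ; fromℕ)
open import Data.Fin.Permutation using (Permutation; permutation)
open import Data.Vec.Functional using (Vector; tail; removeAt; replicate)
open import Data.Fin.Properties using (suc-injective; toℕ-injective; toℕ-fromℕ; toℕ<n; punchInᵢ≢i)
open import Function using (_∘_; id)
open import Data.Sum using (inj₁; inj₂)
open import Data.Empty using (⊥-elim)
open import Data.Product using (_,_; proj₁; proj₂)
open import Relation.Nullary using (¬_; yes; no; map′; decidable-stable)
open import Relation.Binary.Definitions using (Decidable)
open import Relation.Binary.PropositionalEquality as ≡ using (_≡_; _≢_)

private
  variable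
    c ℓ : Level

p∤m! : ∀ {p m} → Prime p → m < p → p ∤ m !
p∤m! {m = zero}  p-prime _ p∣1 with ∣1⇒≡1 p∣1
... | ≡.refl = ¬prime[1] p-prime
p∤m! {m = suc m} p-prime m<p p∣m! with euclidsLemma (suc m) (m !) p-prime p∣m!
... | inj₁ p∣1+m = <⇒≱ m<p (∣⇒≤ p∣1+m)
... | inj₂ p∣m!  = p∤m! p-prime (<-trans (n<1+n m) m<p) p∣m!

p∤m!*n! : ∀ {p m n} → Prime p → m < p → n < p → p ∤ m ! ℕ.* n !
p∤m!*n! p-prime m<p n<p p∣m!*n! with euclidsLemma _ _ p-prime p∣m!*n!
... | inj₁ p∣m! = p∤m! p-prime m<p p∣m!
... | inj₂ p∣n! = p∤m! p-prime n<p p∣n!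

p∣pCk : ∀ {p k} → Prime p → 0 < k → k < p → p ∣ p C k
p∣pCk {p} {k} p-prime 0<k k<p with euclidsLemma (p C k) (k ! * (p ∸ k) !) p-prime p∣pCk*k!*[p∸k]!
  where
  open import Data.Nat using (_*_; _/_)
  instance _ = k !* (p ∸ k) !≢0
  pCk*k!*[p∸k]!≡p! : (p C k) * (k ! * (p ∸ k) !) ≡ p !
  pCk*k!*[p∸k]!≡p! = begin
    (p C k) * (k ! * (p ∸ k) !)                   ≡⟨ ≡.cong (_* (k ! * (p ∸ k) !)) (nCk≡n!/k![n-k]! (<⇒≤ k<p)) ⟩
    p ! / (k ! * (p ∸ k) !) * (k ! * (p ∸ k) !)   ≡⟨ m/n*n≡m (k![n∸k]!∣n! (<⇒≤ k<p)) ⟩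
    p !                                           ∎
    where open ≡.≡-Reasoning
  n∣n! : ∀ {n} → 0 < n → n ∣ n !
  n∣n! {suc n} _ = m∣m*n (n !)
  p∣pCk*k!*[p∸k]! : p ∣ (p C k) * (k ! * (p ∸ k) !)
  p∣pCk*k!*[p∸k]! = ≡.subst (p ∣_) (≡.sym pCk*k!*[p∸k]!≡p!) (n∣n! (<-trans 0<k k<p))
... | inj₁ p∣pCk          = p∣pCk
... | inj₂ p∣k!*[p∸k]!  = ⊥-elim (p∤m!*n! p-prime k<p (∸-monoʳ-< 0<k (<⇒≤ k<p)) p∣k!*[p∸k]!)

2∤p : ∀ {p} → Prime p → p ≢ 2 → 2 ∤ p
2∤p p-prime p≢2 2∣p with prime⇒irreducible p-prime 2∣p
... | inj₁ ()
... | inj₂ 2≡p = p≢2 (≡.sym 2≡p)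

module _ (M : Monoid c ℓ) where

  open Monoid M renaming (_∙_ to _+_; ε to 0#; identityˡ to +-identityˡ; identityʳ to +-identityʳ)
  open import Algebra.Properties.Monoid.Sum M using (sum; sum-cong-≋; sum-replicate-zero)
  open import Relation.Binary.Reasoning.Setoid setoid

  sum-supported-at : ∀ {n} (t : Vector Carrier n) k → (∀ i → i ≢ k → t i ≈ 0#) → sum t ≈ t k
  sum-supported-at {suc n} t zero t≈0 = begin
    t zero + sum (tail t)   ≈⟨ ∙-congˡ (trans (sum-cong-≋ (λ i → t≈0 (suc i) λ ())) (sum-replicate-zero n)) ⟩
    t zero + 0#             ≈⟨ +-identityʳ (t zero) ⟩
    t zero                  ∎
  sum-supported-at {suc n} t (suc k) t≈0 = begin
    t zero + sum (tail t)   ≈⟨ ∙-cong (t≈0 zero λ ()) (sum-supported-at (tail t) k (λ i i≢k → t≈0 (suc i) (i≢k ∘ suc-injective))) ⟩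
    0# + t (suc k)          ≈⟨ +-identityˡ (t (suc k)) ⟩
    t (suc k)               ∎

module _ (M : CommutativeMonoid c ℓ) where

  open CommutativeMonoid M renaming (_∙_ to _+_; ∙-congʳ to +-congʳ; ∙-congˡ to +-congˡ; assoc to +-assoc)
  open import Algebra.Properties.CommutativeMonoid.Sum M using (sum; sum-remove; sum-cong-≋)
  open import Relation.Binary.Reasoning.Setoid setoid

  sum-update : ∀ {n} (s t : Vector Carrier n) k a → (∀ i → i ≢ k → t i ≈ s i) → t k ≈ a + s k →
               sum t ≈ a + sum s
  sum-update {suc n} s t k a t≈s tk≈a+sk = begin
    sum t                                 ≈⟨ sum-remove t ⟩
    t k + sum (removeAt t k)              ≈⟨ ∙-cong tk≈a+sk (sum-cong-≋ (λ j → t≈s _ (punchInᵢ≢i k j))) ⟩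
    (a + s k) + sum (removeAt s k)        ≈⟨ +-assoc a (s k) _ ⟩
    a + (s k + sum (removeAt s k))        ≈⟨ +-congˡ (sum-remove s) ⟨
    a + sum s                             ∎

module _ (R : CommutativeRing c ℓ) where

  open CommutativeRing R hiding (zero)
  open import Algebra.Properties.Semiring.Mult semiring using (_×_; ×1-homo-*)
  open import Algebra.Properties.Semiring.Exp semiring using (_^_)
  import Algebra.Properties.CommutativeSemiring.Binomial commutativeSemiring as Binomial
  open import Relation.Binary.Reasoning.Setoid setoid

  interior-binomials≈0⇒^-distrib-+ : ∀ {m} → 0 < m → (∀ {k} z → 0 < k → k < m → (m C k) × z ≈ 0#) →
                                     ∀ x y → (x + y) ^ m ≈ x ^ m + y ^ m
  interior-binomials≈0⇒^-distrib-+ {suc n} _ mCk×z≈0 x y = begin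
    (x + y) ^ suc n                  ≈⟨ Binomial.theorem (suc n) x y ⟩
    t zero + sum (tail t)            ≈⟨ +-congˡ (sum-supported-at +-monoid (tail t) (fromℕ n) interior≈0) ⟩
    t zero + t (suc (fromℕ n))       ≈⟨ +-cong first last ⟩
    y ^ suc n + x ^ suc n            ≈⟨ +-comm _ _ ⟩
    x ^ suc n + y ^ suc n            ∎
    where
    t : Vector Carrier (suc (suc n))
    t = Binomial.binomialTerm x y (suc n)
    open import Algebra.Properties.Monoid.Sum +-monoid using (sum)
    interior≈0 : ∀ i → i ≢ fromℕ n → t (suc i) ≈ 0#
    interior≈0 i i≢n = mCk×z≈0 _ z<s (s≤s (≤∧≢⇒< (s≤s⁻¹ (toℕ<n i)) toℕi≢n))
      where
      toℕi≢n : toℕ i ≢ n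
      toℕi≢n e = i≢n (toℕ-injective (≡.trans e (≡.sym (toℕ-fromℕ n))))
    first : t zero ≈ y ^ suc n
    first = trans (+-identityʳ _) (*-identityˡ _)
    last : t (suc (fromℕ n)) ≈ x ^ suc n
    last rewrite toℕ-fromℕ n | nCn≡1 (suc n) | n∸n≡0 n = trans (+-identityʳ _) (*-identityʳ _)

  1+1≈0∧2∤m⇒m×1≈1 : 1# + 1# ≈ 0# → ∀ {m} → 2 ∤ m → m × 1# ≈ 1#
  1+1≈0∧2∤m⇒m×1≈1 _     {zero}        2∤0   = ⊥-elim (2∤0 (2 ∣0))
  1+1≈0∧2∤m⇒m×1≈1 _     {suc zero}    _     = +-identityʳ 1#
  1+1≈0∧2∤m⇒m×1≈1 1+1≈0 {suc (suc m)} 2∤2+m = begin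
    1# + (1# + m × 1#)   ≈⟨ +-assoc 1# 1# (m × 1#) ⟨
    1# + 1# + m × 1#     ≈⟨ +-congʳ 1+1≈0 ⟩
    0# + m × 1#          ≈⟨ +-identityˡ (m × 1#) ⟩
    m × 1#               ≈⟨ 1+1≈0∧2∤m⇒m×1≈1 1+1≈0 (2∤2+m ∘ ∣m∣n⇒∣m+n ∣-refl) ⟩
    1#                   ∎

  ×1-homo-^ : ∀ m n → (m ℕ.^ n) × 1# ≈ (m × 1#) ^ n
  ×1-homo-^ m zero    = +-identityʳ 1#
  ×1-homo-^ m (suc n) = trans (×1-homo-* m (m ℕ.^ n)) (*-congˡ (×1-homo-^ m n))

module Frobenius (R : CommutativeRing c ℓ) {p} (p-prime : Prime p) where

  open CommutativeRing R hiding (zero)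
  open import Algebra.Properties.Semiring.Mult semiring using (_×_; ×-congʳ; ×-assoc-*; ×1-homo-*)
  open import Algebra.Properties.Semiring.Exp semiring using (_^_; ^-assocʳ; ^-congˡ)
  open import Relation.Binary.Reasoning.Setoid setoid

  module _ (p×1≈0 : p × 1# ≈ 0#) where

    p∣m⇒m×x≈0 : ∀ {m} x → p ∣ m → m × x ≈ 0#
    p∣m⇒m×x≈0 x (divides t ≡.refl) = begin
      (t ℕ.* p) × x                 ≈⟨ ×-congʳ (t ℕ.* p) (*-identityˡ x) ⟨
      (t ℕ.* p) × (1# * x)          ≈⟨ ×-assoc-* (t ℕ.* p) 1# x ⟨
      (t ℕ.* p) × 1# * x            ≈⟨ *-congʳ (×1-homo-* t p) ⟩
      t × 1# * p × 1# * x           ≈⟨ *-congʳ (*-congˡ p×1≈0) ⟩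
      t × 1# * 0# * x               ≈⟨ *-congʳ (zeroʳ (t × 1#)) ⟩
      0# * x                        ≈⟨ zeroˡ x ⟩
      0#                            ∎

    ^p-distrib-+ : ∀ x y → (x + y) ^ p ≈ x ^ p + y ^ p
    ^p-distrib-+ = interior-binomials≈0⇒^-distrib-+ R (>-nonZero⁻¹ p {{prime⇒nonZero p-prime}})
      (λ z 0<k k<p → p∣m⇒m×x≈0 z (p∣pCk p-prime 0<k k<p))

    ^p^k-distrib-+ : ∀ k x y → (x + y) ^ (p ℕ.^ k) ≈ x ^ (p ℕ.^ k) + y ^ (p ℕ.^ k)
    ^p^k-distrib-+ zero    x y = distribʳ 1# x y
    ^p^k-distrib-+ (suc k) x y = begin
      (x + y) ^ (p ℕ.* p ℕ.^ k)                  ≈⟨ ^-assocʳ (x + y) p (p ℕ.^ k) ⟨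
      ((x + y) ^ p) ^ (p ℕ.^ k)                  ≈⟨ ^-congˡ (p ℕ.^ k) (^p-distrib-+ x y) ⟩
      (x ^ p + y ^ p) ^ (p ℕ.^ k)                ≈⟨ ^p^k-distrib-+ k (x ^ p) (y ^ p) ⟩
      (x ^ p) ^ (p ℕ.^ k) + (y ^ p) ^ (p ℕ.^ k)  ≈⟨ +-cong (^-assocʳ x p (p ℕ.^ k)) (^-assocʳ y p (p ℕ.^ k)) ⟩
      x ^ (p ℕ.* p ℕ.^ k) + y ^ (p ℕ.* p ℕ.^ k)  ∎

module AdditivePower (R : CommutativeRing c ℓ) (q : ℕ) where

  open CommutativeRing R hiding (zero)
  open import Algebra.Properties.Ring ring using (+-identityˡ-unique; +-inverseˡ-unique)
  open import Algebra.Properties.Semiring.Exp semiring using (_^_; ^-congˡ)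

  module _ (^q-distrib-+ : ∀ x y → (x + y) ^ q ≈ x ^ q + y ^ q) where

    0^q≈0 : 0# ^ q ≈ 0#
    0^q≈0 = +-identityˡ-unique (0# ^ q) (0# ^ q)
      (trans (sym (^q-distrib-+ 0# 0#)) (^-congˡ q (+-identityˡ 0#)))

    ^q-distrib-neg : ∀ x → (- x) ^ q ≈ - x ^ q
    ^q-distrib-neg x = +-inverseˡ-unique ((- x) ^ q) (x ^ q)
      (trans (sym (^q-distrib-+ (- x) x)) (trans (^-congˡ q (-‿inverseˡ x)) 0^q≈0))

    ^q-distrib-- : ∀ x y → (x - y) ^ q ≈ x ^ q - y ^ q
    ^q-distrib-- x y = trans (^q-distrib-+ x (- y)) (+-congˡ (^q-distrib-neg y))

module Field (F : CommutativeRing 0ℓ 0ℓ) (isField : IsField F) where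

  open CommutativeRing F hiding (zero)
  open import Algebra.Properties.Ring ring using (-‿distribʳ-*; x∙y⁻¹≈ε⇒x≈y; x≈y⇒x∙y⁻¹≈ε)
  open import Algebra.Properties.Semiring.Mult semiring using (_×_)
  open import Algebra.Properties.Semiring.Exp semiring using (_^_)
  open import Algebra.Properties.CommutativeMonoid.Sum *-commutativeMonoid using () renaming (sum to ∏)
  open import Relation.Binary.Reasoning.Setoid setoid

  1≉0 : ¬ 1# ≈ 0#
  1≉0 = proj₁ isField

  inverse : ∀ {x} → ¬ x ≈ 0# → Carrier
  inverse x≉0 = proj₁ (proj₂ isField _ x≉0)

  x*[x⁻¹*y]≈y : ∀ {x} (x≉0 : ¬ x ≈ 0#) y → x * (inverse x≉0 * y) ≈ y
  x*[x⁻¹*y]≈y {x} x≉0 y = begin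
    x * (inverse x≉0 * y)   ≈⟨ *-assoc x (inverse x≉0) y ⟨
    x * inverse x≉0 * y     ≈⟨ *-congʳ (proj₂ (proj₂ isField x x≉0)) ⟩
    1# * y                  ≈⟨ *-identityˡ y ⟩
    y                       ∎

  x⁻¹*[x*y]≈y : ∀ {x} (x≉0 : ¬ x ≈ 0#) y → inverse x≉0 * (x * y) ≈ y
  x⁻¹*[x*y]≈y {x} x≉0 y = begin
    inverse x≉0 * (x * y)   ≈⟨ *-assoc (inverse x≉0) x y ⟨
    inverse x≉0 * x * y     ≈⟨ *-congʳ (*-comm (inverse x≉0) x) ⟩
    x * inverse x≉0 * y     ≈⟨ *-assoc x (inverse x≉0) y ⟩
    x * (inverse x≉0 * y)   ≈⟨ x*[x⁻¹*y]≈y x≉0 y ⟩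
    y                       ∎

  x≉0∧x*y≈0⇒y≈0 : ∀ {x y} → ¬ x ≈ 0# → x * y ≈ 0# → y ≈ 0#
  x≉0∧x*y≈0⇒y≈0 {x} {y} x≉0 x*y≈0 = begin
    y                       ≈⟨ x⁻¹*[x*y]≈y x≉0 y ⟨
    inverse x≉0 * (x * y)   ≈⟨ *-congˡ x*y≈0 ⟩
    inverse x≉0 * 0#        ≈⟨ zeroʳ (inverse x≉0) ⟩
    0#                      ∎

  x≉0∧y≉0⇒x*y≉0 : ∀ {x y} → ¬ x ≈ 0# → ¬ y ≈ 0# → ¬ x * y ≈ 0#
  x≉0∧y≉0⇒x*y≉0 x≉0 y≉0 x*y≈0 = y≉0 (x≉0∧x*y≈0⇒y≈0 x≉0 x*y≈0)

  x≉0⇒x^n≉0 : ∀ {x} → ¬ x ≈ 0# → ∀ n → ¬ x ^ n ≈ 0#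
  x≉0⇒x^n≉0 x≉0 zero    = 1≉0
  x≉0⇒x^n≉0 x≉0 (suc n) = x≉0∧y≉0⇒x*y≉0 x≉0 (x≉0⇒x^n≉0 x≉0 n)

  ∏≉0 : ∀ {n} (t : Vector Carrier n) → (∀ i → ¬ t i ≈ 0#) → ¬ ∏ t ≈ 0#
  ∏≉0 {zero}  t t≉0 = 1≉0
  ∏≉0 {suc n} t t≉0 = x≉0∧y≉0⇒x*y≉0 (t≉0 zero) (∏≉0 (tail t) (t≉0 ∘ suc))

  *-cancelʳ-≉0 : ∀ {x y z} → ¬ z ≈ 0# → x * z ≈ y * z → x ≈ y
  *-cancelʳ-≉0 {x} {y} {z} z≉0 x*z≈y*z = x∙y⁻¹≈ε⇒x≈y x y (x≉0∧x*y≈0⇒y≈0 z≉0 (begin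
    z * (x - y)          ≈⟨ distribˡ z x (- y) ⟩
    z * x + z * - y      ≈⟨ +-congˡ (-‿distribʳ-* z y) ⟨
    z * x - z * y        ≈⟨ +-cong (*-comm z x) (-‿cong (*-comm z y)) ⟩
    x * z - y * z        ≈⟨ x≈y⇒x∙y⁻¹≈ε x*z≈y*z ⟩
    0#                   ∎))

  two≉0 : ∀ {p} → 2 ∤ p → p × 1# ≈ 0# → ¬ two F ≈ 0#
  two≉0 2∤p p×1≈0 two≈0 = 1≉0 (trans (sym (1+1≈0∧2∤m⇒m×1≈1 F two≈0 2∤p)) p×1≈0)

module FiniteField (F : CommutativeRing 0ℓ 0ℓ) (isField : IsField F) {N} (order : HasOrder F N) where

  open CommutativeRing F hiding (zero)
  open Field F isField
  open import Algebra.Properties.Ring ring using (+-cancelˡ; //-rightDividesˡ; //-rightDividesʳ)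
  open import Algebra.Properties.Semiring.Mult semiring using (_×_)
  open import Algebra.Properties.Semiring.Exp semiring using (_^_)
  open import Relation.Binary.Reasoning.Setoid setoid

  enum : Fin N → Carrier
  enum = proj₁ order

  index : Carrier → Fin N
  index x = proj₁ (proj₂ (proj₂ order) x)

  enum-index : ∀ x → enum (index x) ≈ x
  enum-index x = proj₂ (proj₂ (proj₂ order) x)

  enum-injective : ∀ {i j} → enum i ≈ enum j → i ≡ j
  enum-injective = proj₁ (proj₂ order) _ _

  index-enum : ∀ i → index (enum i) ≡ i
  index-enum i = enum-injective (enum-index (enum i))

  index-cong : ∀ {x y} → x ≈ y → index x ≡ index y
  index-cong {x} {y} x≈y = enum-injective (trans (enum-index x) (trans x≈y (sym (enum-index y))))

  _≟_ : Decidable _≈_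
  x ≟ y = map′ (λ e → trans (sym (enum-index x)) (trans (reflexive (≡.cong enum e)) (enum-index y)))
               index-cong (index x Fin.≟ index y)

  module _ {a ℓa} (M : CommutativeMonoid a ℓa) where

    open CommutativeMonoid M using () renaming (Carrier to A; _≈_ to _≈ᴹ_)
    open import Algebra.Properties.CommutativeMonoid.Sum M using (sum; sum-permute; sum-cong-≋)

    sum-invariant : (h : Carrier → A) → (∀ {x y} → x ≈ y → h x ≈ᴹ h y) →
                    (φ ψ : Carrier → Carrier) → (∀ {x y} → x ≈ y → φ x ≈ φ y) → (∀ {x y} → x ≈ y → ψ x ≈ ψ y) →
                    (∀ x → φ (ψ x) ≈ x) → (∀ x → ψ (φ x) ≈ x) →
                    sum (λ i → h (φ (enum i))) ≈ᴹ sum (λ i → h (enum i))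
    sum-invariant h h-cong φ ψ φ-cong ψ-cong φψ≈id ψφ≈id = M.sym (M.trans
      (sum-permute (h ∘ enum) π) (sum-cong-≋ (λ i → h-cong (enum-index (φ (enum i))))))
      where
      module M = CommutativeMonoid M
      permuted : (Carrier → Carrier) → Fin N → Fin N
      permuted f i = index (f (enum i))
      permuted-inverse : ∀ {f g} → (∀ {x y} → x ≈ y → f x ≈ f y) → (∀ x → f (g x) ≈ x) →
                         ∀ i → permuted f (permuted g i) ≡ i
      permuted-inverse {f} {g} f-cong fg≈id i =
        ≡.trans (index-cong (trans (f-cong (enum-index (g (enum i)))) (fg≈id (enum i)))) (index-enum i)
      π : Permutation N N
      π = permutation (permuted φ) (permuted ψ) (permuted-inverse φ-cong φψ≈id) (permuted-inverse ψ-cong ψφ≈id)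

  open import Algebra.Properties.CommutativeMonoid.Sum +-commutativeMonoid using (sum; ∑-distrib-+; sum-replicate)
  open import Algebra.Properties.CommutativeMonoid.Sum *-commutativeMonoid
    using () renaming (sum to ∏; sum-replicate to ∏-replicate; ∑-distrib-+ to ∏-distrib-*)

  N×1≈0 : N × 1# ≈ 0#
  N×1≈0 = +-cancelˡ (sum enum) (N × 1#) 0# (begin
    sum enum + N × 1#                  ≈⟨ +-congˡ (sum-replicate N) ⟨
    sum enum + sum (replicate N 1#)    ≈⟨ ∑-distrib-+ enum (replicate N 1#) ⟨
    sum (λ i → enum i + 1#)            ≈⟨ sum-invariant +-commutativeMonoid id id (_+ 1#) (_- 1#)
                                            +-congʳ +-congʳ (//-rightDividesˡ 1#) (//-rightDividesʳ 1#) ⟩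
    sum enum                           ≈⟨ +-identityʳ (sum enum) ⟨
    sum enum + 0#                      ∎)

  x^n≈0⇒x≈0 : ∀ {x} n → x ^ n ≈ 0# → x ≈ 0#
  x^n≈0⇒x≈0 {x} n x^n≈0 = decidable-stable (x ≟ 0#) (λ x≉0 → x≉0⇒x^n≉0 x≉0 n x^n≈0)

  m^n≡N⇒m×1≈0 : ∀ m n → m ℕ.^ n ≡ N → m × 1# ≈ 0#
  m^n≡N⇒m×1≈0 m n ≡.refl = x^n≈0⇒x≈0 n (trans (sym (×1-homo-^ F m n)) N×1≈0)

  -- Replacing 0 by 1 lets the Fermat product below run over all of F instead of F ∖ {0}.
  0↦1 : Carrier → Carrier
  0↦1 u with u ≟ 0#
  ... | yes _ = 1#
  ... | no  _ = u

  0↦1-≈0 : ∀ {u} → u ≈ 0# → 0↦1 u ≈ 1#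
  0↦1-≈0 {u} u≈0 with u ≟ 0#
  ... | yes _   = refl
  ... | no  u≉0 = ⊥-elim (u≉0 u≈0)

  0↦1-≉0 : ∀ {u} → ¬ u ≈ 0# → 0↦1 u ≈ u
  0↦1-≉0 {u} u≉0 with u ≟ 0#
  ... | yes u≈0 = ⊥-elim (u≉0 u≈0)
  ... | no  _   = refl

  0↦1-cong : ∀ {u v} → u ≈ v → 0↦1 u ≈ 0↦1 v
  0↦1-cong {u} u≈v with u ≟ 0#
  ... | yes u≈0 = sym (0↦1-≈0 (trans (sym u≈v) u≈0))
  ... | no  u≉0 = trans u≈v (sym (0↦1-≉0 (u≉0 ∘ trans u≈v)))

  0↦1≉0 : ∀ u → ¬ 0↦1 u ≈ 0#
  0↦1≉0 u with u ≟ 0#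
  ... | yes _   = 1≉0
  ... | no  u≉0 = u≉0

  ∏0↦1-*-invariant : ∀ {x} → ¬ x ≈ 0# → ∏ (λ i → 0↦1 (x * enum i)) ≈ ∏ (0↦1 ∘ enum)
  ∏0↦1-*-invariant {x} x≉0 = sum-invariant *-commutativeMonoid 0↦1 0↦1-cong (x *_) (inverse x≉0 *_)
    *-congˡ *-congˡ (x*[x⁻¹*y]≈y x≉0) (x⁻¹*[x*y]≈y x≉0)

  x*0↦1[u]≈0↦1[x*u] : ∀ {x u} → ¬ x ≈ 0# → ¬ u ≈ 0# → x * 0↦1 u ≈ 0↦1 (x * u)
  x*0↦1[u]≈0↦1[x*u] x≉0 u≉0 = trans (*-congˡ (0↦1-≉0 u≉0)) (sym (0↦1-≉0 (x≉0∧y≉0⇒x*y≉0 x≉0 u≉0)))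

  x≉0⇒x^N≈x : ∀ {x} → ¬ x ≈ 0# → x ^ N ≈ x
  x≉0⇒x^N≈x {x} x≉0 = *-cancelʳ-≉0 (∏≉0 (0↦1 ∘ enum) (0↦1≉0 ∘ enum)) (begin
    x ^ N * ∏ (0↦1 ∘ enum)               ≈⟨ *-congʳ (∏-replicate N) ⟨
    ∏ (replicate N x) * ∏ (0↦1 ∘ enum)   ≈⟨ ∏-distrib-* (replicate N x) (0↦1 ∘ enum) ⟨
    ∏ (λ i → x * 0↦1 (enum i))           ≈⟨ sum-update *-commutativeMonoid (λ i → 0↦1 (x * enum i)) _ (index 0#) x
                                              away-from-0 at-0 ⟩
    x * ∏ (λ i → 0↦1 (x * enum i))       ≈⟨ *-congˡ (∏0↦1-*-invariant x≉0) ⟩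
    x * ∏ (0↦1 ∘ enum)                   ∎)
    where
    away-from-0 : ∀ i → i ≢ index 0# → x * 0↦1 (enum i) ≈ 0↦1 (x * enum i)
    away-from-0 i i≢0 = x*0↦1[u]≈0↦1[x*u] x≉0 (i≢0 ∘ ≡.trans (≡.sym (index-enum i)) ∘ index-cong)
    at-0 : x * 0↦1 (enum (index 0#)) ≈ x * 0↦1 (x * enum (index 0#))
    at-0 = *-congˡ (0↦1-cong (trans (enum-index 0#) (sym (trans (*-congˡ (enum-index 0#)) (zeroʳ x)))))

  x≈0⇒x^N≈x : ∀ {x} → x ≈ 0# → x ^ N ≈ x
  x≈0⇒x^N≈x {x} x≈0 = x^n≈x (index 0#)
    where
    x^n≈x : ∀ {n} → Fin n → x ^ n ≈ x
    x^n≈x {suc n} _ = trans (*-congʳ x≈0) (trans (zeroˡ (x ^ n)) (sym x≈0))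

  x^N≈x : ∀ x → x ^ N ≈ x
  x^N≈x x with x ≟ 0#
  ... | yes x≈0 = x≈0⇒x^N≈x x≈0
  ... | no  x≉0 = x≉0⇒x^N≈x x≉0

-- Algebra.Solver.Ring needs a coefficient ring with decidable equality; ℤ maps into every ring.
module IntegerCoefficients (R : CommutativeRing c ℓ) where

  open CommutativeRing R hiding (zero)
  open import Algebra.Properties.Ring ring using (-0#≈0#; -‿involutive; -‿distribˡ-*; -‿distribʳ-*; -‿+-comm; ⁻¹-anti-homo‿-; //-rightDividesʳ)
  open import Algebra.Properties.Semiring.Mult semiring using (_×_; ×-homo-+; ×1-homo-*)
  open import Algebra.Solver.Ring.AlmostCommutativeRing using (fromCommutativeRing; _-Raw-AlmostCommutative⟶_)
  open import Data.Integer as ℤ using (ℤ; +_; -[1+_]; _⊖_; _◃_; sign; ∣_∣)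
  import Data.Integer.Properties as ℤ
  open import Data.Sign as Sign using (Sign)
  open import Data.Maybe using (Maybe; just; nothing)
  open import Relation.Nullary using (yes; no)
  open import Relation.Binary.Reasoning.Setoid setoid

  signed : Sign → Carrier → Carrier
  signed Sign.+ x = x
  signed Sign.- x = - x

  signed-cong : ∀ s {x y} → x ≈ y → signed s x ≈ signed s y
  signed-cong Sign.+ = id
  signed-cong Sign.- = -‿cong

  signed-* : ∀ s t x y → signed (s Sign.* t) (x * y) ≈ signed s x * signed t y
  signed-* Sign.+ Sign.+ x y = refl
  signed-* Sign.+ Sign.- x y = -‿distribʳ-* x y
  signed-* Sign.- Sign.+ x y = -‿distribˡ-* x y
  signed-* Sign.- Sign.- x y = begin
    x * y         ≈⟨ -‿involutive (x * y) ⟨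
    - - (x * y)   ≈⟨ -‿cong (-‿distribˡ-* x y) ⟩
    - (- x * y)   ≈⟨ -‿distribʳ-* (- x) y ⟩
    - x * - y     ∎

  ⟦_⟧ℤ : ℤ → Carrier
  ⟦ i ⟧ℤ = signed (sign i) (∣ i ∣ × 1#)

  ◃-homo : ∀ s n → ⟦ s ◃ n ⟧ℤ ≈ signed s (n × 1#)
  ◃-homo Sign.+ zero    = refl
  ◃-homo Sign.- zero    = sym -0#≈0#
  ◃-homo Sign.+ (suc n) = refl
  ◃-homo Sign.- (suc n) = refl

  -‿homo : ∀ i → ⟦ ℤ.- i ⟧ℤ ≈ - ⟦ i ⟧ℤ
  -‿homo -[1+ n ]    = sym (-‿involutive _)
  -‿homo (+ zero)    = sym -0#≈0#
  -‿homo (+ (suc n)) = refl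

  ∸-homo : ∀ {m n} → n ℕ.≤ m → (m ∸ n) × 1# ≈ m × 1# - n × 1#
  ∸-homo {m} {n} n≤m = begin
    (m ∸ n) × 1#                     ≈⟨ //-rightDividesʳ (n × 1#) ((m ∸ n) × 1#) ⟨
    (m ∸ n) × 1# + n × 1# - n × 1#   ≈⟨ +-congʳ (×-homo-+ 1# (m ∸ n) n) ⟨
    (m ∸ n ℕ.+ n) × 1# - n × 1#      ≡⟨ ≡.cong (λ k → k × 1# - n × 1#) (m∸n+n≡m n≤m) ⟩
    m × 1# - n × 1#                  ∎

  ⊖-homo : ∀ m n → ⟦ m ⊖ n ⟧ℤ ≈ m × 1# - n × 1#
  ⊖-homo m n with ≤-total n m
  ... | inj₁ n≤m = begin
    ⟦ m ⊖ n ⟧ℤ         ≡⟨ ≡.cong ⟦_⟧ℤ (ℤ.⊖-≥ n≤m) ⟩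
    (m ∸ n) × 1#       ≈⟨ ∸-homo n≤m ⟩
    m × 1# - n × 1#    ∎
  ... | inj₂ m≤n = begin
    ⟦ m ⊖ n ⟧ℤ               ≡⟨ ≡.cong ⟦_⟧ℤ (ℤ.⊖-≤ m≤n) ⟩
    ⟦ ℤ.- (+ (n ∸ m)) ⟧ℤ     ≈⟨ -‿homo (+ (n ∸ m)) ⟩
    - ((n ∸ m) × 1#)         ≈⟨ -‿cong (∸-homo m≤n) ⟩
    - (n × 1# - m × 1#)      ≈⟨ ⁻¹-anti-homo‿- (n × 1#) (m × 1#) ⟩
    m × 1# - n × 1#          ∎

  +-homo : ∀ i j → ⟦ i ℤ.+ j ⟧ℤ ≈ ⟦ i ⟧ℤ + ⟦ j ⟧ℤ
  +-homo -[1+ m ] -[1+ n ] = begin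
    - (suc (suc (m ℕ.+ n)) × 1#)      ≡⟨ ≡.cong (λ k → - (k × 1#)) (+-suc (suc m) n) ⟨
    - ((suc m ℕ.+ suc n) × 1#)        ≈⟨ -‿cong (×-homo-+ 1# (suc m) (suc n)) ⟩
    - (suc m × 1# + suc n × 1#)       ≈⟨ -‿+-comm _ _ ⟨
    - (suc m × 1#) + - (suc n × 1#)   ∎
  +-homo -[1+ m ] (+ n)    = trans (⊖-homo n (suc m)) (+-comm _ _)
  +-homo (+ m)    -[1+ n ] = ⊖-homo m (suc n)
  +-homo (+ m)    (+ n)    = ×-homo-+ 1# m n

  *-homo : ∀ i j → ⟦ i ℤ.* j ⟧ℤ ≈ ⟦ i ⟧ℤ * ⟦ j ⟧ℤ
  *-homo i j = begin
    ⟦ i ℤ.* j ⟧ℤ                                            ≈⟨ ◃-homo (sign i Sign.* sign j) (∣ i ∣ ℕ.* ∣ j ∣) ⟩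
    signed (sign i Sign.* sign j) ((∣ i ∣ ℕ.* ∣ j ∣) × 1#)   ≈⟨ signed-cong (sign i Sign.* sign j) (×1-homo-* ∣ i ∣ ∣ j ∣) ⟩
    signed (sign i Sign.* sign j) (∣ i ∣ × 1# * ∣ j ∣ × 1#)  ≈⟨ signed-* (sign i) (sign j) _ _ ⟩
    ⟦ i ⟧ℤ * ⟦ j ⟧ℤ                                         ∎

  homomorphism : CommutativeRing.rawRing ℤ.+-*-commutativeRing -Raw-AlmostCommutative⟶ fromCommutativeRing R
  homomorphism = record
    { ⟦_⟧    = ⟦_⟧ℤ
    ; +-homo = +-homo
    ; *-homo = *-homo
    ; -‿homo = -‿homo
    ; 0-homo = refl
    ; 1-homo = +-identityʳ 1#
    }

  ≟-coefficients : ∀ i j → Maybe (⟦ i ⟧ℤ ≈ ⟦ j ⟧ℤ)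
  ≟-coefficients i j with i ℤ.≟ j
  ... | yes ≡.refl = just refl
  ... | no _     = nothing

  open import Algebra.Solver.Ring _ _ homomorphism ≟-coefficients public

module DeterminantB (F : CommutativeRing 0ℓ 0ℓ) (isField : IsField F) (q : ℕ) where

  open CommutativeRing F hiding (zero)
  open Field F isField
  open AdditivePower F q
  open import Algebra.Properties.Semiring.Exp semiring using (_^_; ^-congˡ; ^-assocʳ)
  open IntegerCoefficients F using (solve; _:=_; _:+_; _:-_; _:*_)
  open import Relation.Binary.Reasoning.Setoid setoid

  det3-cong : ∀ {a₁ a₂ a₃ a₄ a₅ a₆ a₇ a₈ a₉ b₁ b₂ b₃ b₄ b₅ b₆ b₇ b₈ b₉} →
              a₁ ≈ b₁ → a₂ ≈ b₂ → a₃ ≈ b₃ → a₄ ≈ b₄ → a₅ ≈ b₅ → a₆ ≈ b₆ → a₇ ≈ b₇ → a₈ ≈ b₈ → a₉ ≈ b₉ →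
              det3 F a₁ a₂ a₃ a₄ a₅ a₆ a₇ a₈ a₉ ≈ det3 F b₁ b₂ b₃ b₄ b₅ b₆ b₇ b₈ b₉
  det3-cong h₁ h₂ h₃ h₄ h₅ h₆ h₇ h₈ h₉ = +-cong
    (+-cong (+-cong (*-cong (*-cong h₁ h₅) h₉) (*-cong (*-cong h₂ h₆) h₇)) (*-cong (*-cong h₃ h₄) h₈))
    (-‿cong (+-cong (+-cong (*-cong (*-cong h₃ h₅) h₇) (*-cong (*-cong h₂ h₄) h₉)) (*-cong (*-cong h₁ h₆) h₈)))

  two*x≈x+x : ∀ x → two F * x ≈ x + x
  two*x≈x+x x = trans (distribʳ x 1# 1#) (+-cong (*-identityˡ x) (*-identityˡ x))

  E : Carrier → Carrier → Carrier
  E u v = u + u - v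

  D : Carrier → Carrier → Carrier → Carrier
  D u v w = E u v - w

  L : Carrier → Carrier → Carrier → Carrier
  L u v w = u + v - w

  det3-DE≈2LLL : ∀ u v w → det3 F (D u v w) (E u v) (E u w) (E v u) (D v w u) (E v w) (E w u) (E w v) (D w u v)
                           ≈ L u v w * L v w u * L w u v + L u v w * L v w u * L w u v
  det3-DE≈2LLL = solve 3 (λ u v w →
    let det3ᴱ = λ m₁₁ m₁₂ m₁₃ m₂₁ m₂₂ m₂₃ m₃₁ m₃₂ m₃₃ →
                  (m₁₁ :* m₂₂ :* m₃₃ :+ m₁₂ :* m₂₃ :* m₃₁ :+ m₁₃ :* m₂₁ :* m₃₂)
                  :- (m₁₃ :* m₂₂ :* m₃₁ :+ m₁₂ :* m₂₁ :* m₃₃ :+ m₁₁ :* m₂₃ :* m₃₂)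
        Eᴱ = λ u v → u :+ u :- v
        Dᴱ = λ u v w → Eᴱ u v :- w
        Lᴱ = λ u v w → u :+ v :- w
        LLLᴱ = Lᴱ u v w :* Lᴱ v w u :* Lᴱ w u v
    in det3ᴱ (Dᴱ u v w) (Eᴱ u v) (Eᴱ u w) (Eᴱ v u) (Dᴱ v w u) (Eᴱ v w) (Eᴱ w u) (Eᴱ w v) (Dᴱ w u v)
       := LLLᴱ :+ LLLᴱ) refl

  L+L≈u+u : ∀ u v w → L u v w + L w u v ≈ u + u
  L+L≈u+u = solve 3 (λ u v w → (u :+ v :- w) :+ (w :+ u :- v) := u :+ u) refl

  module _ (^q-distrib-+ : ∀ x y → (x + y) ^ q ≈ x ^ q + y ^ q) where

    σ : Carrier → Carrier
    σ x = x ^ q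

    σ-cong : ∀ {x y} → x ≈ y → σ x ≈ σ y
    σ-cong = ^-congˡ q

    σ-E : ∀ {u v u′ v′} → σ u ≈ u′ → σ v ≈ v′ → σ (E u v) ≈ E u′ v′
    σ-E {u} {v} {u′} {v′} σu≈u′ σv≈v′ = begin
      σ (u + u - v)       ≈⟨ ^q-distrib-- ^q-distrib-+ (u + u) v ⟩
      σ (u + u) - σ v     ≈⟨ +-cong (^q-distrib-+ u u) (-‿cong σv≈v′) ⟩
      σ u + σ u - v′      ≈⟨ +-congʳ (+-cong σu≈u′ σu≈u′) ⟩
      u′ + u′ - v′        ∎

    σ-D : ∀ {u v w u′ v′ w′} → σ u ≈ u′ → σ v ≈ v′ → σ w ≈ w′ → σ (D u v w) ≈ D u′ v′ w′
    σ-D {u} {v} {w} σu≈u′ σv≈v′ σw≈w′ =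
      trans (^q-distrib-- ^q-distrib-+ (E u v) w) (+-cong (σ-E σu≈u′ σv≈v′) (-‿cong σw≈w′))

    σ-L : ∀ {u v w u′ v′ w′} → σ u ≈ u′ → σ v ≈ v′ → σ w ≈ w′ → σ (L u v w) ≈ L u′ v′ w′
    σ-L {u} {v} {w} σu≈u′ σv≈v′ σw≈w′ =
      trans (^q-distrib-- ^q-distrib-+ (u + v) w) (+-cong (trans (^q-distrib-+ u v) (+-cong σu≈u′ σv≈v′)) (-‿cong σw≈w′))

    σ-≈0 : ∀ {x y} → σ x ≈ y → x ≈ 0# → y ≈ 0#
    σ-≈0 σx≈y x≈0 = trans (sym σx≈y) (trans (σ-cong x≈0) (0^q≈0 ^q-distrib-+))

    module _ {ε} (ε^q³≈ε : ε ^ (q ℕ.^ 3) ≈ ε) where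

      e₀ e₁ e₂ : Carrier
      e₀ = ε
      e₁ = ε ^ q
      e₂ = ε ^ (q ℕ.* q)

      σe₀ : σ e₀ ≈ e₁
      σe₀ = refl

      σe₁ : σ e₁ ≈ e₂
      σe₁ = ^-assocʳ ε q q

      σe₂ : σ e₂ ≈ e₀
      σe₂ = begin
        (ε ^ (q ℕ.* q)) ^ q    ≈⟨ ^-assocʳ ε (q ℕ.* q) q ⟩
        ε ^ (q ℕ.* q ℕ.* q)    ≡⟨ ≡.cong (ε ^_) q*q*q≡q^3 ⟩
        ε ^ (q ℕ.^ 3)          ≈⟨ ε^q³≈ε ⟩
        ε                      ∎
        where
        q*q*q≡q^3 : q ℕ.* q ℕ.* q ≡ q ℕ.^ 3
        q*q*q≡q^3 = ≡.trans (ℕₚ.*-assoc q q q) (≡.cong (λ r → q ℕ.* (q ℕ.* r)) (≡.sym (ℕₚ.*-identityʳ q)))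

      detB≈2LLL : detB F q ε ≈ two F * (L e₀ e₁ e₂ * L e₁ e₂ e₀ * L e₂ e₀ e₁)
      detB≈2LLL = begin
        detB F q ε
          ≈⟨ det3-cong a≈ σb (σ²-of σc (σ-E σe₂ σe₁))
                       c≈ σa (σ²-of σb (σ-E σe₀ σe₁))
                       b≈ σc (σ²-of σa (σ-D σe₁ σe₂ σe₀)) ⟩
        det3 F (D e₀ e₁ e₂) (E e₀ e₁) (E e₀ e₂) (E e₁ e₀) (D e₁ e₂ e₀) (E e₁ e₂) (E e₂ e₀) (E e₂ e₁) (D e₂ e₀ e₁)
          ≈⟨ det3-DE≈2LLL e₀ e₁ e₂ ⟩
        LLL + LLL
          ≈⟨ two*x≈x+x LLL ⟨
        two F * LLL ∎
        where
        LLL : Carrier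
        LLL = L e₀ e₁ e₂ * L e₁ e₂ e₀ * L e₂ e₀ e₁
        a≈ : two F * e₀ - e₁ - e₂ ≈ D e₀ e₁ e₂
        a≈ = +-congʳ (+-congʳ (two*x≈x+x e₀))
        b≈ : two F * e₂ - e₀ ≈ E e₂ e₀
        b≈ = +-congʳ (two*x≈x+x e₂)
        c≈ : two F * e₁ - e₀ ≈ E e₁ e₀
        c≈ = +-congʳ (two*x≈x+x e₁)
        σa : σ (two F * e₀ - e₁ - e₂) ≈ D e₁ e₂ e₀
        σa = trans (σ-cong a≈) (σ-D σe₀ σe₁ σe₂)
        σb : σ (two F * e₂ - e₀) ≈ E e₀ e₁
        σb = trans (σ-cong b≈) (σ-E σe₂ σe₀)
        σc : σ (two F * e₁ - e₀) ≈ E e₂ e₁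
        σc = trans (σ-cong c≈) (σ-E σe₁ σe₀)
        σ²-of : ∀ {x y z} → σ x ≈ y → σ y ≈ z → x ^ (q ℕ.* q) ≈ z
        σ²-of {x} σx≈y σy≈z = trans (sym (^-assocʳ x q q)) (trans (σ-cong σx≈y) σy≈z)

      module _ (two≉0 : ¬ two F ≈ 0#) (ε≉0 : ¬ ε ≈ 0#) where

        L₀ L₁ L₂ : Carrier
        L₀ = L e₀ e₁ e₂
        L₁ = L e₁ e₂ e₀
        L₂ = L e₂ e₀ e₁

        σL₀ : σ L₀ ≈ L₁
        σL₀ = σ-L σe₀ σe₁ σe₂

        σL₁ : σ L₁ ≈ L₂
        σL₁ = σ-L σe₁ σe₂ σe₀

        σL₂ : σ L₂ ≈ L₀
        σL₂ = σ-L σe₂ σe₀ σe₁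

        L₀≉0 : ¬ L₀ ≈ 0#
        L₀≉0 L₀≈0 = ε≉0 (x≉0∧x*y≈0⇒y≈0 two≉0 (begin
          two F * e₀    ≈⟨ two*x≈x+x e₀ ⟩
          e₀ + e₀       ≈⟨ L+L≈u+u e₀ e₁ e₂ ⟨
          L₀ + L₂       ≈⟨ +-cong L₀≈0 (σ-≈0 σL₁ (σ-≈0 σL₀ L₀≈0)) ⟩
          0# + 0#       ≈⟨ +-identityʳ 0# ⟩
          0#            ∎))

        L₁≉0 : ¬ L₁ ≈ 0#
        L₁≉0 = L₀≉0 ∘ σ-≈0 σL₂ ∘ σ-≈0 σL₁

        L₂≉0 : ¬ L₂ ≈ 0#
        L₂≉0 = L₀≉0 ∘ σ-≈0 σL₂

        detB≉0 : ¬ detB F q ε ≈ 0#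
        detB≉0 detB≈0 = x≉0∧y≉0⇒x*y≉0 two≉0 (x≉0∧y≉0⇒x*y≉0 (x≉0∧y≉0⇒x*y≉0 L₀≉0 L₁≉0) L₂≉0)
          (trans (sym detB≈2LLL) detB≈0)

open import Data.Nat using (_^_)

proposition2p4 : (q : ℕ) → IsOddPrimePower q →
    (F : CommutativeRing 0ℓ 0ℓ) → IsFiniteFieldOfOrder F (q ^ 3) →
    (ε : CommutativeRing.Carrier F) → ¬ (CommutativeRing._≈_ F ε (CommutativeRing.0# F)) →
    ¬ (CommutativeRing._≈_ F (detB F q ε) (CommutativeRing.0# F))
proposition2p4 _ (p , k , p-prime , p≢2 , _ , ≡.refl) F (isField , order) ε ε≉0 =
  detB≉0 (^p^k-distrib-+ p×1≈0 k) (x^N≈x ε) (two≉0 (2∤p p-prime p≢2) p×1≈0) ε≉0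
  where
  open Field F isField
  open FiniteField F isField order
  open Frobenius F p-prime
  open DeterminantB F isField (p ^ k)
  open CommutativeRing F using (_≈_; 1#; 0#)
  open import Algebra.Properties.Semiring.Mult (CommutativeRing.semiring F) using (_×_)
  p×1≈0 : p × 1# ≈ 0#
  p×1≈0 = m^n≡N⇒m×1≈0 p (k ℕ.* 3) (≡.sym (ℕₚ.^-*-assoc p k 3))
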